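{- Let $G$ be a 2-edge-connected graph with $n$ vertices and $m$ edges, let $T$ be a DFS tree of $G$ with root $r$, and let $\{C_1,\ldots,C_{m-n+1}\}$ be the chain decomposition of $G$ with respect to $T$. Then: (1) For every chain $C_i$, $s(C_i)\le t(C_i)$. (2) Every chain $C_i$, $i\ge 2$, has a parent chain $p(C_i)$; we have $s(p(C_i))\le s(C_i)$ and $p(C_i)=C_j$ for some $j<i$. (3) For $i\ge 2$: if $t(C_i)\ne r$ then $t(p(C_i))<t(C_i)$; if $t(C_i)=r$ then $t(p(C_i))=t(C_i)$. (4) If $u\le v$ are vertices, $u$ s-belongs to chain $C$ and $v$ s-belongs to chain $D$, then $C\le D$. (5) If $u\le t(D)$ for a chain $D$ and $u$ s-belongs to chain $C$, then $C\le D$. (6) For $i\ge 2$: $s(C_i)$ s-belongs to a chain $C_j$ with $j<i$.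
   Context: Graphs are finite and undirected, may have parallel edges, have no self-loops, and (standing convention of the paper) have minimum degree at least three. $T$ is a depth-first-search tree of the connected graph $G$ rooted at $r$; for vertices $x,y$ write $x\le y$ ($x$ is an ancestor of $y$) if $x$ lies on the tree path from $r$ to $y$, and $x<y$ if moreover $x\ne y$; $p(v)$ denotes the parent of $v\ne r$, and $u\rightarrow_T v$ the tree path between $u$ and $v$. Every non-tree edge joins a vertex to one of its proper ancestors (back-edge). Tree-edges $\{u,p(u)\}$ are oriented from $u$ to $p(u)$; a back-edge $\{x,y\}$ with $x<y$ is oriented from $x$ to $y$. Chain decomposition: initially no vertex is visited; process the vertices $v$ in the order of DFS discovery: declare $v$ visited, then for every back-edge oriented from $v$ to some $w$, walk along the tree path from $w$ towards $r$ until the first already visited vertex $x$ is met; the back-edge $(v,w)$ together with the tree path from $w$ to $x$ forms a new chain $C$ with source $s(C)=v$ and target $t(C)=x$, and all inner vertices of $C$ are declared visited. Chains are numbered $C_1,C_2,\ldots$ in order of construction. For 2-edge-connected $G$ the chains partition $E(G)$. The root $r$ s-belongs to $C_1$, and a vertex $v\ne r$ s-belongs to the chain containing the edge $\{v,p(v)\}$. For a chain $C\ne C_1$, its parent $p(C)$ is the chain to which $t(C)$ s-belongs; this makes the chains a tree rooted at $C_1$, and $C\le D$ ($C<D$) means $C$ is an ancestor (proper ancestor) of $D$ in this tree. -}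

module Defs where

open import Data.Nat using (ℕ; zero; suc; _<_; _≥_)
open import Data.Fin using (Fin; toℕ; _≟_)
open import Data.Bool using (Bool; true; false; if_then_else_; _∨_)
open import Data.List using (List; []; _∷_; _++_; length; filterᵇ; allFin; lookup; map; foldl)
open import Data.List.Membership.Propositional using (_∈_)
open import Data.List.Relation.Unary.Unique.Propositional using (Unique)
open import Data.Product using (Σ; ∃; ∃-syntax; _×_; _,_; proj₁; proj₂)
open import Data.Sum using (_⊎_)
open import Data.Unit using (⊤)
open import Function.Definitions using (Injective)
open import Function.Bundles using (_⇔_)
open import Relation.Nullary using (¬_)
open import Relation.Nullary.Decidable using (⌊_⌋)
open import Relation.Binary.PropositionalEquality using (_≡_; _≢_)

record Graph (n m : ℕ) : Set where
  field
    ends   : Fin m → Fin n × Fin n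
    noLoop : ∀ e → proj₁ (ends e) ≢ proj₂ (ends e)
open Graph public

Joins : ∀ {n m} → Graph n m → Fin m → Fin n → Fin n → Set
Joins G e u w = (ends G e ≡ (u , w)) ⊎ (ends G e ≡ (w , u))

incidentᵇ : ∀ {n m} → Graph n m → Fin n → Fin m → Bool
incidentᵇ G v e = ⌊ proj₁ (ends G e) ≟ v ⌋ ∨ ⌊ proj₂ (ends G e) ≟ v ⌋

degree : ∀ {n m} → Graph n m → Fin n → ℕ
degree {m = m} G v = length (filterᵇ (incidentᵇ G v) (allFin m))

MinDegree≥3 : ∀ {n m} → Graph n m → Set
MinDegree≥3 G = ∀ v → degree G v ≥ 3

data Walk {n m} (G : Graph n m) (ok : Fin m → Set) : Fin n → Fin n → Set where
  here : ∀ {v} → Walk G ok v v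
  step : ∀ {u w v} (e : Fin m) → ok e → Joins G e u w → Walk G ok w v → Walk G ok u v

Connected : ∀ {n m} → Graph n m → Set
Connected {m = m} G = ∀ u v → Walk G (λ (_ : Fin m) → ⊤) u v

TwoEdgeConnected : ∀ {n m} → Graph n m → Set
TwoEdgeConnected G = Connected G × (∀ e → ∀ u v → Walk G (λ f → f ≢ e) u v)

-- Rooted trees given by a parent function (par root ≡ root).

iter : ∀ {A : Set} → (A → A) → ℕ → A → A
iter f zero    x = x
iter f (suc k) x = f (iter f k x)

-- x ≤ y : x lies on the tree path from the root to y (x is an ancestor of y)
Anc : ∀ {n} → (Fin n → Fin n) → Fin n → Fin n → Set
Anc par x y = ∃[ k ] iter par k y ≡ x

PAnc : ∀ {n} → (Fin n → Fin n) → Fin n → Fin n → Set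
PAnc par x y = Anc par x y × x ≢ y

-- A depth-first search of G, started at `root`, producing the DFS tree T
-- (parent function `par`, tree edge `te v` = {v, par v} for v ≠ root) and
-- the discovery order `ord` (ord k = k-th discovered vertex, 0-based).
-- The fields dfsStep characterise exactly the runs of recursive DFS:
-- the (k+1)-st discovered vertex y is an (undiscovered) neighbour of the
-- deepest vertex on the current stack (tree path root → previously
-- discovered vertex) that still has an undiscovered neighbour, and y is
-- attached to it by the tree edge.
-- Also included: `backOrder v`, the (arbitrary) order in which the
-- back-edges oriented from v are handled by the chain decomposition.

DiscoveredBefore : ∀ {n} → (Fin n → Fin n) → Fin n → Fin n → Set
DiscoveredBefore ord w k = ∃[ k′ ] (toℕ k′ < toℕ k) × (ord k′ ≡ w)

NonTree : ∀ {n m} → Fin n → (Fin n → Fin m) → Fin m → Set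
NonTree root te e = ∀ u → u ≢ root → te u ≢ e

BackFrom : ∀ {n m} → Graph n m → Fin n → (Fin n → Fin n) → (Fin n → Fin m) →
           Fin n → Fin m → Set
BackFrom G root par te v e = NonTree root te e × ∃[ w ] (Joins G e v w × PAnc par v w)

record DFS {n m} (G : Graph n m) : Set where
  field
    root    : Fin n
    par     : Fin n → Fin n
    parRoot : par root ≡ root
    te      : Fin n → Fin m
    teJoins : ∀ v → v ≢ root → Joins G (te v) v (par v)
    ord     : Fin n → Fin n
    ordInj  : Injective _≡_ _≡_ ord
    ordZero : ∀ k → toℕ k ≡ 0 → ord k ≡ root
    dfsStep : ∀ (k k′ : Fin n) → toℕ k ≡ suc (toℕ k′) →
                Anc par (par (ord k)) (ord k′)
              × (∀ z → PAnc par (par (ord k)) z → Anc par z (ord k′) →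
                   ∀ e w → Joins G e z w → DiscoveredBefore ord w k)
    -- standard fact about DFS trees recorded in the paper's conventions
    -- (a consequence of the fields above): every non-tree edge is a back-edge
    nonTreeBack : ∀ e → NonTree root te e →
                  ∃[ u ] ∃[ w ] (Joins G e u w × PAnc par u w)
    backOrder  : Fin n → List (Fin m)
    backUnique : ∀ v → Unique (backOrder v)
    backSpec   : ∀ v e → (e ∈ backOrder v) ⇔ BackFrom G root par te v e
open DFS public

record Chain (n m : ℕ) : Set where
  constructor mkChain
  field
    src   : Fin n          -- s(C): the vertex the back-edge is oriented from
    bedge : Fin m          -- the back-edge (s(C), w)
    inner : List (Fin n)   -- tree path w → t(C) without t(C) (inner vertices)
    tgt   : Fin n
open Chain public

module ChainDecomposition {n m} (G : Graph n m) (D : DFS G) where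

  edges : Chain n m → List (Fin m)
  edges C = bedge C ∷ map (te D) (inner C)

  otherEnd : Fin m → Fin n → Fin n
  otherEnd e v = if ⌊ proj₁ (ends G e) ≟ v ⌋ then proj₂ (ends G e) else proj₁ (ends G e)

  mark : Fin n → (Fin n → Bool) → (Fin n → Bool)
  mark v vis u = if ⌊ u ≟ v ⌋ then true else vis u

  markAll : List (Fin n) → (Fin n → Bool) → (Fin n → Bool)
  markAll []       vis = vis
  markAll (x ∷ xs) vis = mark x (markAll xs vis)

  -- walk from w towards the root until the first visited vertex x;
  -- returns (vertices passed before x, x); fuel n always suffices
  climb : ℕ → (Fin n → Bool) → Fin n → List (Fin n) × Fin n
  climb zero    vis w = [] , w
  climb (suc f) vis w with vis w
  ... | true  = [] , w
  ... | false with climb f vis (par D w)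
  ...   | is , x = (w ∷ is) , x

  State : Set
  State = (Fin n → Bool) × List (Chain n m)

  processEdge : Fin n → State → Fin m → State
  processEdge v (vis , cs) e with climb n vis (otherEnd e v)
  ... | is , x = markAll is vis , (cs ++ (mkChain v e is x ∷ []))

  processVertex : State → Fin n → State
  processVertex (vis , cs) v = foldl (processEdge v) (mark v vis , cs) (backOrder D v)

  -- C₁, C₂, … in order of construction (index i : Fin _ is C_{i+1})
  chains : List (Chain n m)
  chains = proj₂ (foldl (λ st k → processVertex st (ord D k)) ((λ _ → false) , []) (allFin n))

  Idx : Set
  Idx = Fin (length chains)

  C : Idx → Chain n m
  C = lookup chains

  _≤T_ _<T_ : Fin n → Fin n → Set
  x ≤T y = Anc (par D) x y
  x <T y = PAnc (par D) x y

  r : Fin n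
  r = root D

  SBelongs : Fin n → Idx → Set
  SBelongs v i = (v ≡ r × toℕ i ≡ 0) ⊎ (v ≢ r × te D v ∈ edges (C i))

  IsParent : Idx → Idx → Set
  IsParent i j = toℕ i ≢ 0 × SBelongs (tgt (C i)) j

  data _≤C_ : Idx → Idx → Set where
    ≤C-refl : ∀ {i} → i ≤C i
    ≤C-step : ∀ {i j k} → i ≤C k → IsParent j k → i ≤C j

module Submission where

-- Every vertex has a discovery time pos v, and since DFS
--     attaches each new vertex to a vertex on the current stack, a parent is
--     discovered before its child.  This makes the ancestor relation ≤T a
--     partial order whose down-sets are chains (any two ancestors of a vertex
--     are comparable), and it bounds every climb towards the root.
--   * 2-edge-connectivity.  For v ≠ r the edge {v, p(v)} is not a bridge, so
--     some back-edge (s, u) has s < v ≤ u; hence v is already visited when the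
--     algorithm reaches it, and each new chain starts at a visited vertex.
--   * Invariant.  During the run the visited vertices are exactly r and the
--     inner vertices of the chains built so far, they are closed under taking
--     ancestors, and every chain has the shape "back-edge (s,w), then tree path
--     w → t with s ≤ t", its target and source are r or inner vertices of
--     earlier chains, inner vertex sets are disjoint, and sources appear in
--     discovery order.

open import Defs
open import Data.Nat using (ℕ; zero; suc; _<_; _≤_; _+_; _∸_; z≤n; s≤s)
open import Data.Nat.Properties hiding (_≟_)
open import Data.Fin as F using (Fin; toℕ; fromℕ<; _≟_)
import Data.Fin.Properties as FP
open import Data.Bool using (Bool; true; false)
open import Data.List using (List; []; _∷_; _++_; length; lookup; foldl; tabulate; allFin)
open import Data.List.Membership.Propositional using (_∈_)
open import Data.List.Membership.Propositional.Properties using (∈-map⁺; ∈-map⁻)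
open import Data.List.Relation.Unary.Any using (here; there)
open import Data.Product using (Σ; ∃; ∃-syntax; _×_; _,_; proj₁; proj₂)
open import Data.Sum using (_⊎_; inj₁; inj₂; map₂)
open import Data.Empty using (⊥; ⊥-elim)
open import Relation.Nullary using (¬_; Dec; yes; no)
open import Relation.Nullary.Decidable using (map′)
open import Relation.Binary.PropositionalEquality
open import Function using (id)
open import Function.Definitions using (Injective)
open import Function.Bundles using (Equivalence)

iter-suc : ∀ {A : Set} (f : A → A) k x → iter f k (f x) ≡ iter f (suc k) x
iter-suc f zero    x = refl
iter-suc f (suc k) x = cong f (iter-suc f k x)

iter-+ : ∀ {A : Set} (f : A → A) a b x → iter f (a + b) x ≡ iter f a (iter f b x)
iter-+ f zero    b x = refl
iter-+ f (suc a) b x = cong f (iter-+ f a b x)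

iter-∸ : ∀ {A : Set} (f : A → A) {a b} x → a ≤ b → iter f (b ∸ a) (iter f a x) ≡ iter f b x
iter-∸ f {a} {b} x a≤b = trans (sym (iter-+ f (b ∸ a) a x)) (cong (λ k → iter f k x) (m∸n+n≡m a≤b))

iter-fixed : ∀ {A : Set} (f : A → A) {x} → f x ≡ x → ∀ k → iter f k x ≡ x
iter-fixed f fx≡x zero    = refl
iter-fixed f fx≡x (suc k) = trans (cong f (iter-fixed f fx≡x k)) fx≡x

-- Pigeonhole: an injective map of a finite set to itself is onto.  Needed to
-- give every vertex a discovery time.
injective⇒surjective : ∀ {n} (f : Fin n → Fin n) → Injective _≡_ _≡_ f →
                       ∀ v → ∃ λ k → f k ≡ v
injective⇒surjective {zero}  f inj ()
injective⇒surjective {suc n} f inj v with FP.any? (λ k → f k ≟ v)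
... | yes hit = hit
... | no miss = ⊥-elim (<-irrefl refl (FP.injective⇒≤ {f = g} g-injective))
  where
  -- f avoids v, so it factors injectively through Fin n
  g : Fin (suc n) → Fin n
  g k = F.punchOut {i = v} {j = f k} (λ eq → miss (k , sym eq))
  g-injective : Injective _≡_ _≡_ g
  g-injective {a} {b} eq =
    inj (FP.punchOut-injective {i = v} (λ e → miss (a , sym e)) (λ e → miss (b , sym e)) eq)

fin-zero : ∀ {n} → Fin n → Σ (Fin n) (λ z → toℕ z ≡ 0)
fin-zero F.zero    = F.zero , refl
fin-zero (F.suc _) = F.zero , refl

-- At xs i x: x sits at position i of xs.  Chains are identified by their
-- position in the growing list of chains, so membership alone is not enough.
data At {A : Set} : List A → ℕ → A → Set where
  at0 : ∀ {x xs} → At (x ∷ xs) 0 x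
  atS : ∀ {x xs i y} → At xs i y → At (x ∷ xs) (suc i) y

At-++ˡ : ∀ {A : Set} {xs ys : List A} {i y} → At xs i y → At (xs ++ ys) i y
At-++ˡ at0      = at0
At-++ˡ (atS at) = atS (At-++ˡ at)

At-snoc : ∀ {A : Set} (xs : List A) c → At (xs ++ c ∷ []) (length xs) c
At-snoc []       c = at0
At-snoc (x ∷ xs) c = atS (At-snoc xs c)

At-snoc⁻ : ∀ {A : Set} (xs : List A) {c i y} → At (xs ++ c ∷ []) i y →
           At xs i y ⊎ (i ≡ length xs × y ≡ c)
At-snoc⁻ []       at0       = inj₂ (refl , refl)
At-snoc⁻ []       (atS ())
At-snoc⁻ (x ∷ xs) at0       = inj₁ at0
At-snoc⁻ (x ∷ xs) (atS at) with At-snoc⁻ xs at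
... | inj₁ at′             = inj₁ (atS at′)
... | inj₂ (refl , refl)   = inj₂ (refl , refl)

At-< : ∀ {A : Set} {xs : List A} {i y} → At xs i y → i < length xs
At-< at0      = s≤s z≤n
At-< (atS at) = s≤s (At-< at)

At-lookup : ∀ {A : Set} (xs : List A) (i : Fin (length xs)) → At xs (toℕ i) (lookup xs i)
At-lookup (x ∷ xs) F.zero    = at0
At-lookup (x ∷ xs) (F.suc i) = atS (At-lookup xs i)

At⇒lookup : ∀ {A : Set} {xs : List A} {j y} → At xs j y →
            ∃ λ (i : Fin (length xs)) → toℕ i ≡ j × lookup xs i ≡ y
At⇒lookup at0 = F.zero , refl , refl
At⇒lookup (atS at) with At⇒lookup at
... | i , refl , refl = F.suc i , refl , refl

foldl-invariant : ∀ {A S : Set} (g : S → A → S) (Q : List A → S → Set) (xs : List A) →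
  (∀ e hs s → e ∈ xs → Q hs s → Q (e ∷ hs) (g s e)) →
  ∀ s → Q [] s → ∃ λ hs → (∀ e → e ∈ xs → e ∈ hs) × Q hs (foldl g s xs)
foldl-invariant g Q xs handle s q =
  let hs , xs⊆hs , _ , q′ = go xs (λ e e∈ → e∈) [] s q in hs , xs⊆hs , q′
  where
  go : ∀ ys → (∀ e → e ∈ ys → e ∈ xs) → ∀ ds s → Q ds s →
       ∃ λ hs → (∀ e → e ∈ ys → e ∈ hs) × (∀ e → e ∈ ds → e ∈ hs) × Q hs (foldl g s ys)
  go []       _   ds s q = ds , (λ e ()) , (λ e e∈ → e∈) , q
  go (y ∷ ys) sub ds s q with go ys (λ e e∈ → sub e (there e∈)) (y ∷ ds) (g s y)
                                    (handle y ds s (sub y (here refl)) q)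
  ... | hs , ys⊆hs , yds⊆hs , q′ =
    hs , (λ { e (here refl) → yds⊆hs e (here refl) ; e (there e∈) → ys⊆hs e e∈ })
       , (λ e e∈ → yds⊆hs e (there e∈)) , q′

foldl-allFin : ∀ {S : Set} {n} (g : S → Fin n → S) (P : ℕ → S → Set) →
  (∀ x s → P (toℕ x) s → P (suc (toℕ x)) (g s x)) →
  ∀ s → P 0 s → P n (foldl g s (allFin n))
foldl-allFin {n = n} g P advance s p = go id 0 (λ i → refl) s p
  where
  go : ∀ {k} (f : Fin k → Fin n) off → (∀ i → toℕ (f i) ≡ off + toℕ i) →
       ∀ s → P off s → P (off + k) (foldl g s (tabulate f))
  go {zero} f off _ s p = subst (λ z → P z s) (sym (+-identityʳ off)) p
  go {suc k} f off f≡ s p =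
    subst (λ z → P z (foldl g s′ (tabulate (λ i → f (F.suc i))))) (sym (+-suc off k))
      (go (λ i → f (F.suc i)) (suc off) (λ i → trans (f≡ (F.suc i)) (+-suc off (toℕ i))) s′ p′)
    where
    s′ = g s (f F.zero)
    f0≡off : toℕ (f F.zero) ≡ off
    f0≡off = trans (f≡ F.zero) (+-identityʳ off)
    p′ : P (suc off) s′
    p′ = subst (λ z → P (suc z) s′) f0≡off (advance (f F.zero) s (subst (λ z → P z s) (sym f0≡off) p))

module TreeOrder {n m} (G : Graph n m) (D : DFS G) where
  open ChainDecomposition G D
  open import Data.List.Membership.DecPropositional (_≟_ {n}) using (_∈?_)

  parent : Fin n → Fin n
  parent = par D

  ≤T-refl : ∀ {x} → x ≤T x
  ≤T-refl = 0 , refl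

  ≤T-trans : ∀ {x y z} → x ≤T y → y ≤T z → x ≤T z
  ≤T-trans {z = z} (a , refl) (b , refl) = a + b , iter-+ parent a b z

  ≤T-parent : ∀ {v w} → v ≤T parent w → v ≤T w
  ≤T-parent {w = w} (k , e) = suc k , trans (sym (iter-suc parent k w)) e

  ≤T-unparent : ∀ {v u} → v ≤T u → v ≢ u → v ≤T parent u
  ≤T-unparent (zero  , e) v≢u = ⊥-elim (v≢u (sym e))
  ≤T-unparent {u = u} (suc k , e) _ = k , trans (iter-suc parent k u) e

  iter-root : ∀ k → iter parent k r ≡ r
  iter-root = iter-fixed parent (parRoot D)

  ≤T-root : ∀ {y} → y ≤T r → y ≡ r
  ≤T-root (k , e) = trans (sym e) (iter-root k)

  index : Fin n → Fin n
  index v = proj₁ (injective⇒surjective (ord D) (ordInj D) v)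

  ord-index : ∀ v → ord D (index v) ≡ v
  ord-index v = proj₂ (injective⇒surjective (ord D) (ordInj D) v)

  pos : Fin n → ℕ
  pos v = toℕ (index v)

  pos-ord : ∀ k → pos (ord D k) ≡ toℕ k
  pos-ord k = cong toℕ (ordInj D (ord-index (ord D k)))

  pos-injective : ∀ {u v} → pos u ≡ pos v → u ≡ v
  pos-injective {u} {v} e =
    trans (sym (ord-index u)) (trans (cong (ord D) (FP.toℕ-injective e)) (ord-index v))

  pos-root : pos r ≡ 0
  pos-root = let z , z≡0 = fin-zero r in trans (cong pos (sym (ordZero D z z≡0))) (trans (pos-ord z) z≡0)

  pos≡0 : ∀ {y} → pos y ≡ 0 → y ≡ r
  pos≡0 e = pos-injective (trans e (sym pos-root))

  previous : ∀ {t} (k : Fin n) → toℕ k ≡ suc t → Σ (Fin n) λ k′ → toℕ k′ ≡ t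
  previous {t} k e = fromℕ< t<n , FP.toℕ-fromℕ< t<n
    where
    t<n : t < n
    t<n = <-trans (n<1+n t) (subst (_< n) e (FP.toℕ<n k))

  parent-on-stack : ∀ {t} (k k′ : Fin n) → toℕ k ≡ suc t → toℕ k′ ≡ t →
                    parent (ord D k) ≤T ord D k′
  parent-on-stack k k′ e e′ = proj₁ (dfsStep D k k′ (trans e (cong suc (sym e′))))

  ancestor-earlier : ∀ t (k : Fin n) → toℕ k ≡ t → ∀ {x} → x ≤T ord D k → pos x ≤ t
  ancestor-earlier zero k e x≤ =
    ≤-reflexive (trans (cong pos (≤T-root (subst (_ ≤T_) (ordZero D k e) x≤))) pos-root)
  ancestor-earlier (suc t) k e (zero , refl) = ≤-reflexive (trans (pos-ord k) e)
  ancestor-earlier (suc t) k e {x} (suc j , x≡) =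
    let k′ , e′ = previous k e
        x≤parent : x ≤T parent (ord D k)
        x≤parent = j , trans (iter-suc parent j (ord D k)) x≡
    in m≤n⇒m≤1+n (ancestor-earlier t k′ e′ (≤T-trans x≤parent (parent-on-stack k k′ e e′)))

  parent-pos< : ∀ v → v ≢ r → pos (parent v) < pos v
  parent-pos< v v≢r with toℕ (index v) in e
  ... | zero  = ⊥-elim (v≢r (trans (sym (ord-index v)) (ordZero D (index v) e)))
  ... | suc t = let k′ , e′ = previous (index v) e in
    s≤s (subst (λ u → pos (parent u) ≤ t) (ord-index v)
                (ancestor-earlier t k′ e′ (parent-on-stack (index v) k′ e e′)))

  parent-pos≤ : ∀ v → pos (parent v) ≤ pos v
  parent-pos≤ v with v ≟ r
  ... | yes refl = ≤-reflexive (cong pos (parRoot D))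
  ... | no v≢r   = <⇒≤ (parent-pos< v v≢r)

  pos-iter : ∀ j y → pos (iter parent j y) ≤ pos y
  pos-iter zero    y = ≤-refl
  pos-iter (suc j) y = ≤-trans (parent-pos≤ (iter parent j y)) (pos-iter j y)

  ≤T⇒pos≤ : ∀ {x y} → x ≤T y → pos x ≤ pos y
  ≤T⇒pos≤ {y = y} (k , refl) = pos-iter k y

  pos-iter-suc : ∀ j y → y ≢ r → pos (iter parent (suc j) y) < pos y
  pos-iter-suc j y y≢r = subst (λ z → pos z < pos y) (iter-suc parent j y)
                               (≤-<-trans (pos-iter j (parent y)) (parent-pos< y y≢r))

  <T⇒pos< : ∀ {x y} → x <T y → pos x < pos y
  <T⇒pos< ((zero , e) , x≢y) = ⊥-elim (x≢y (sym e))
  <T⇒pos< {x} {y} ((suc k , refl) , x≢y) with y ≟ r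
  ... | yes refl = ⊥-elim (x≢y (iter-root (suc k)))
  ... | no y≢r   = pos-iter-suc k y y≢r

  iter-<T : ∀ k y → 0 < k → y ≢ r → iter parent k y <T y
  iter-<T (suc j) y _ y≢r = (suc j , refl) , λ eq → <-irrefl (cong pos eq) (pos-iter-suc j y y≢r)

  ≤T-pos-antisym : ∀ {x y} → x ≤T y → pos y ≤ pos x → x ≡ y
  ≤T-pos-antisym {x} {y} x≤y py≤px with x ≟ y
  ... | yes x≡y = x≡y
  ... | no x≢y  = ⊥-elim (<⇒≱ (<T⇒pos< (x≤y , x≢y)) py≤px)

  ≤T-antisym : ∀ {x y} → x ≤T y → y ≤T x → x ≡ y
  ≤T-antisym x≤y y≤x = ≤T-pos-antisym x≤y (≤T⇒pos≤ y≤x)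

  reach-root : ∀ b y → pos y ≤ b → iter parent b y ≡ r
  reach-root zero    y py≤0 = pos≡0 (n≤0⇒n≡0 py≤0)
  reach-root (suc b) y py≤b with y ≟ r
  ... | yes refl = iter-root (suc b)
  ... | no y≢r   = trans (sym (iter-suc parent b y))
                         (reach-root b (parent y) (≤-pred (≤-trans (parent-pos< y y≢r) py≤b)))

  r≤T : ∀ y → r ≤T y
  r≤T y = pos y , reach-root (pos y) y ≤-refl

  comparable : ∀ {x y z} → x ≤T z → y ≤T z → x ≤T y ⊎ y ≤T x
  comparable {z = z} (a , refl) (b , refl) with ≤-total a b
  ... | inj₁ a≤b = inj₂ (b ∸ a , iter-∸ parent z a≤b)
  ... | inj₂ b≤a = inj₁ (a ∸ b , iter-∸ parent z b≤a)

  ≰⇒<T : ∀ {x y z} → x ≤T z → y ≤T z → ¬ (x ≤T y) → y <T x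
  ≰⇒<T {x} x≤z y≤z x≰y with comparable x≤z y≤z
  ... | inj₁ x≤y = ⊥-elim (x≰y x≤y)
  ... | inj₂ y≤x = y≤x , λ y≡x → x≰y (subst (x ≤T_) (sym y≡x) ≤T-refl)

  path : Fin n → ℕ → List (Fin n)
  path w zero    = []
  path w (suc l) = w ∷ path (parent w) l

  path⁻ : ∀ {y} w l → y ∈ path w l → ∃ λ t → t < l × iter parent t w ≡ y
  path⁻ w (suc l) (here y≡w) = 0 , s≤s z≤n , sym y≡w
  path⁻ w (suc l) (there y∈) =
    let t , t<l , e = path⁻ (parent w) l y∈ in suc t , s≤s t<l , trans (sym (iter-suc parent t w)) e

  path⁺ : ∀ w l t → t < l → iter parent t w ∈ path w l
  path⁺ w (suc l) zero    _         = here refl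
  path⁺ w (suc l) (suc t) (s≤s t<l) =
    there (subst (_∈ path (parent w) l) (iter-suc parent t w) (path⁺ (parent w) l t t<l))

  path-or-above : ∀ w l k → iter parent k w ∈ path w l ⊎ iter parent k w ≤T iter parent l w
  path-or-above w l k with k <? l
  ... | yes k<l = inj₁ (path⁺ w l k k<l)
  ... | no k≮l  = inj₂ (k ∸ l , iter-∸ parent w (≮⇒≥ k≮l))

  ancestor-of-path : ∀ {u y} w l → y ∈ path w l → u ≤T y →
                     u ∈ path w l ⊎ u ≤T iter parent l w
  ancestor-of-path w l y∈ (a , refl) with path⁻ w l y∈
  ... | t , _ , refl = subst (λ z → z ∈ path w l ⊎ z ≤T iter parent l w) (iter-+ parent a t w)
                             (path-or-above w l (a + t))

  -- x ≤T y is decidable: it suffices to search the path from y to the root.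
  _≤T?_ : ∀ x y → Dec (x ≤T y)
  x ≤T? y = map′ from to (x ∈? path y (suc (pos y)))
    where
    from : x ∈ path y (suc (pos y)) → x ≤T y
    from x∈ = let t , _ , e = path⁻ y (suc (pos y)) x∈ in t , e
    r∈ : r ∈ path y (suc (pos y))
    r∈ = subst (_∈ path y (suc (pos y))) (reach-root (pos y) y ≤-refl)
               (path⁺ y (suc (pos y)) (pos y) ≤-refl)
    to : x ≤T y → x ∈ path y (suc (pos y))
    to (k , refl) with path-or-above y (suc (pos y)) k
    ... | inj₁ x∈ = x∈
    ... | inj₂ x≤ = subst (_∈ path y (suc (pos y)))
                          (sym (≤T-root (subst (_ ≤T_) (reach-root (suc (pos y)) y (n≤1+n _)) x≤))) r∈

  joins-cases : ∀ {e a b c d} → Joins G e a b → Joins G e c d → (a ≡ c × b ≡ d) ⊎ (a ≡ d × b ≡ c)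
  joins-cases (inj₁ p) (inj₁ q) = let h = trans (sym p) q in inj₁ (cong proj₁ h , cong proj₂ h)
  joins-cases (inj₁ p) (inj₂ q) = let h = trans (sym p) q in inj₂ (cong proj₁ h , cong proj₂ h)
  joins-cases (inj₂ p) (inj₁ q) = let h = trans (sym p) q in inj₂ (cong proj₂ h , cong proj₁ h)
  joins-cases (inj₂ p) (inj₂ q) = let h = trans (sym p) q in inj₁ (cong proj₂ h , cong proj₁ h)

  joins-unique : ∀ {e v w w′} → Joins G e v w → Joins G e v w′ → w ≡ w′
  joins-unique j j′ with joins-cases j j′
  ... | inj₁ (_ , w≡w′)     = w≡w′
  ... | inj₂ (v≡w′ , w≡v) = trans w≡v v≡w′

  te-injective : ∀ {u v} → u ≢ r → v ≢ r → te D u ≡ te D v → u ≡ v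
  te-injective {u} {v} u≢r v≢r eq
    with joins-cases (teJoins D u u≢r) (subst (λ e → Joins G e v (parent v)) (sym eq) (teJoins D v v≢r))
  ... | inj₁ (u≡v , _) = u≡v
  ... | inj₂ (u≡pv , pu≡v) =
    ⊥-elim (<-asym (subst (λ z → pos z < pos v) (sym u≡pv) (parent-pos< v v≢r))
                   (subst (λ z → pos z < pos u) pu≡v (parent-pos< u u≢r)))

  otherEnd-joins : ∀ {e v w} → Joins G e v w → otherEnd e v ≡ w
  otherEnd-joins {e} {v} (inj₁ p) rewrite p with v ≟ v
  ... | yes _ = refl
  ... | no v≢v = ⊥-elim (v≢v refl)
  otherEnd-joins {e} {v} (inj₂ p) with proj₁ (ends G e) ≟ v
  ... | yes q = ⊥-elim (noLoop G e (trans q (sym (cong proj₂ p))))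
  ... | no _  = cong proj₁ p

module Steps {n m} (G : Graph n m) (D : DFS G) where
  open ChainDecomposition G D
  open TreeOrder G D

  Back : Fin n → Fin m → Fin n → Set
  Back s e w = NonTree r (te D) e × Joins G e s w × s <T w

  mark-self : ∀ v vis → mark v vis v ≡ true
  mark-self v vis with v ≟ v
  ... | yes _ = refl
  ... | no v≢v = ⊥-elim (v≢v refl)

  mark-mono : ∀ v vis u → vis u ≡ true → mark v vis u ≡ true
  mark-mono v vis u e with u ≟ v
  ... | yes _ = refl
  ... | no _  = e

  mark⁻ : ∀ v vis u → mark v vis u ≡ true → u ≡ v ⊎ vis u ≡ true
  mark⁻ v vis u e with u ≟ v
  ... | yes u≡v = inj₁ u≡v
  ... | no _    = inj₂ e

  mark-visited : ∀ v vis → vis v ≡ true → ∀ u → mark v vis u ≡ vis u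
  mark-visited v vis vis-v u with u ≟ v
  ... | yes refl = sym vis-v
  ... | no _     = refl

  markAll-mono : ∀ is vis u → vis u ≡ true → markAll is vis u ≡ true
  markAll-mono []       vis u e = e
  markAll-mono (x ∷ is) vis u e = mark-mono x (markAll is vis) u (markAll-mono is vis u e)

  markAll-∈ : ∀ is vis u → u ∈ is → markAll is vis u ≡ true
  markAll-∈ (x ∷ is) vis u (here refl) = mark-self u (markAll is vis)
  markAll-∈ (x ∷ is) vis u (there u∈)  = mark-mono x (markAll is vis) u (markAll-∈ is vis u u∈)

  markAll⁻ : ∀ is vis u → markAll is vis u ≡ true → u ∈ is ⊎ vis u ≡ true
  markAll⁻ []       vis u e = inj₂ e
  markAll⁻ (x ∷ is) vis u e with mark⁻ x (markAll is vis) u e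
  ... | inj₁ u≡x = inj₁ (here u≡x)
  ... | inj₂ e′ with markAll⁻ is vis u e′
  ...   | inj₁ u∈ = inj₁ (there u∈)
  ...   | inj₂ vu = inj₂ vu

  markAll-start : ∀ w l vis → vis (iter parent l w) ≡ true → markAll (path w l) vis w ≡ true
  markAll-start w zero    vis e = e
  markAll-start w (suc l) vis _ = markAll-∈ (path w (suc l)) vis w (here refl)

  ClimbsTo : (Fin n → Bool) → Fin n → List (Fin n) × Fin n → Set
  ClimbsTo vis w (is , x) =
    ∃ λ l → is ≡ path w l × x ≡ iter parent l w × vis x ≡ true ×
            (∀ t → t < l → vis (iter parent t w) ≡ false)

  climb-spec : ∀ f vis w → (∃ λ j → j ≤ f × vis (iter parent j w) ≡ true) →
               ClimbsTo vis w (climb f vis w)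
  climb-spec zero    vis w (zero , _ , e) = 0 , refl , refl , e , λ t ()
  climb-spec (suc f) vis w reach with vis w in vis-w
  ... | true  = 0 , refl , refl , vis-w , λ t ()
  ... | false with climb f vis (parent w) | climb-spec f vis (parent w) (reach-from-parent reach)
    where
    reach-from-parent : (∃ λ j → j ≤ suc f × vis (iter parent j w) ≡ true) →
                        ∃ λ j → j ≤ f × vis (iter parent j (parent w)) ≡ true
    reach-from-parent (zero  , _ , e)        with () ← trans (sym vis-w) e
    reach-from-parent (suc j , s≤s j≤f , e) = j , j≤f , trans (cong vis (iter-suc parent j w)) e
  ...   | is , x | l , refl , refl , vis-x , unvisited =
    suc l , refl , iter-suc parent l w , vis-x ,
    λ { zero _ → vis-w ; (suc t) (s≤s t<l) → trans (cong vis (sym (iter-suc parent t w))) (unvisited t t<l) }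

  leaving-edge : ∀ v {ok : Fin m → Set} {a b} → Walk G ok a b → v ≤T a → ¬ (v ≤T b) →
                 ∃ λ e → ∃ λ x → ∃ λ y → ok e × Joins G e x y × v ≤T x × ¬ (v ≤T y)
  leaving-edge v here                           v≤a v≰b = ⊥-elim (v≰b v≤a)
  leaving-edge v (step {w = w} e ok-e j rest) v≤a v≰b with v ≤T? w
  ... | yes v≤w = leaving-edge v rest v≤w v≰b
  ... | no v≰w  = e , _ , w , ok-e , j , v≤a , v≰w

  leaving-non-tree : ∀ {v e x y} → e ≢ te D v → Joins G e x y → v ≤T x → ¬ (v ≤T y) →
                     NonTree r (te D) e
  leaving-non-tree {v} {e} {x} e≢tev jxy v≤x v≰y y′ y′≢r te≡e
    with joins-cases (subst (λ f → Joins G f y′ (parent y′)) te≡e (teJoins D y′ y′≢r)) jxy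
  ... | inj₂ (refl , refl) = v≰y (≤T-parent v≤x)
  ... | inj₁ (refl , refl) with x ≟ v
  ...   | yes refl = e≢tev (sym te≡e)
  ...   | no x≢v   = v≰y (≤T-unparent v≤x (λ v≡x → x≢v (sym v≡x)))

  leaving-back-edge : ∀ {v e x y} → NonTree r (te D) e → Joins G e x y → v ≤T x → ¬ (v ≤T y) →
                      y <T v × Back y e x
  leaving-back-edge {v} {e} {x} {y} nt jxy v≤x v≰y with nonTreeBack D e nt
  ... | a , b , jab , a<b with joins-cases jab jxy
  ...   | inj₁ (refl , refl) = ⊥-elim (v≰y (≤T-trans v≤x (proj₁ a<b)))
  ...   | inj₂ (refl , refl) = ≰⇒<T v≤x (proj₁ a<b) v≰y , nt , jab , a<b

  -- For v ≠ r the tree edge {v, p(v)} is not a bridge, so some back-edge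
  -- (s, u) jumps over it: s < v ≤ u.
  covering-back-edge : TwoEdgeConnected G → ∀ v → v ≢ r →
                       ∃ λ s → ∃ λ e → ∃ λ u → s <T v × v ≤T u × Back s e u
  covering-back-edge tec v v≢r
    with leaving-edge v (proj₂ tec (te D v) v r) ≤T-refl (λ v≤r → v≢r (≤T-root v≤r))
  ... | e , x , y , e≢tev , jxy , v≤x , v≰y =
    let y<v , back = leaving-back-edge (leaving-non-tree e≢tev jxy v≤x v≰y) jxy v≤x v≰y
    in y , e , x , y<v , v≤x , back

  record ChainShape (c : Chain n m) : Set where
    field
      far           : Fin n
      len           : ℕ
      inner≡path    : inner c ≡ path far len
      tgt≡end       : tgt c ≡ iter parent len far
      src≤tgt       : src c ≤T tgt c
      inner-nonroot : ∀ y → y ∈ inner c → y ≢ r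
      back-nontree  : NonTree r (te D) (bedge c)

  inner-below : ∀ {c y} → ChainShape c → y ∈ inner c → tgt c <T y
  inner-below {c} {y} S y∈
    with path⁻ (ChainShape.far S) (ChainShape.len S) (subst (y ∈_) (ChainShape.inner≡path S) y∈)
  ... | t , t<l , refl =
    subst (_<T iter parent t far) (trans (iter-∸ parent far (<⇒≤ t<l)) (sym tgt≡end))
          (iter-<T (len ∸ t) _ (m<n⇒0<n∸m t<l) (inner-nonroot _ y∈))
    where open ChainShape S

  inner-between : ∀ {c y u} → ChainShape c → y ∈ inner c → tgt c <T u → u ≤T y → u ∈ inner c
  inner-between {c} S y∈ (tgt≤u , tgt≢u) u≤y
    with ancestor-of-path (ChainShape.far S) (ChainShape.len S) (subst (_ ∈_) (ChainShape.inner≡path S) y∈) u≤y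
  ... | inj₁ u∈    = subst (_ ∈_) (sym (ChainShape.inner≡path S)) u∈
  ... | inj₂ u≤end =
    ⊥-elim (tgt≢u (≤T-antisym tgt≤u (subst (_ ≤T_) (sym (ChainShape.tgt≡end S)) u≤end)))

  climbed-unvisited : ∀ {vis : Fin n → Bool} {w l y} → (∀ t → t < l → vis (iter parent t w) ≡ false) →
                      y ∈ path w l → vis y ≡ true → ⊥
  climbed-unvisited {w = w} {l} unvisited y∈ vy with path⁻ w l y∈
  ... | t , t<l , refl with () ← trans (sym (unvisited t t<l)) vy

  -- If r and v are visited, the chain built from a back-edge (v, w) by such a
  -- climb has the expected shape: in particular v ≤ p^l(w), as v is visited
  -- and lies above w.
  climbed-chain-shape : ∀ {vis : Fin n → Bool} {v e w l} → vis r ≡ true → vis v ≡ true → Back v e w →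
                        (∀ t → t < l → vis (iter parent t w) ≡ false) →
                        ChainShape (mkChain v e (path w l) (iter parent l w))
  climbed-chain-shape {vis} {v} {w = w} {l} vis-r vis-v (nt , _ , v<w) unvisited = record
    { far = w ; len = l ; inner≡path = refl ; tgt≡end = refl ; src≤tgt = v≤end
    ; inner-nonroot = λ y y∈ y≡r →
        climbed-unvisited {vis} unvisited y∈ (subst (λ z → vis z ≡ true) (sym y≡r) vis-r)
    ; back-nontree = nt }
    where
    v≤end : v ≤T iter parent l w
    v≤end with proj₁ v<w
    ... | a , refl with path-or-above w l a
    ...   | inj₁ v∈ = ⊥-elim (climbed-unvisited {vis} unvisited v∈ vis-v)
    ...   | inj₂ v≤ = v≤

module Invariant {n m} (G : Graph n m) (D : DFS G) where
  open ChainDecomposition G D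
  open TreeOrder G D
  open Steps G D

  InInner : List (Chain n m) → Fin n → Set
  InInner cs u = ∃ λ i → ∃ λ c → At cs i c × u ∈ inner c

  RootOrInner : List (Chain n m) → Fin n → Set
  RootOrInner cs u = u ≡ r ⊎ InInner cs u

  RootOrEarlier : List (Chain n m) → ℕ → Fin n → Set
  RootOrEarlier cs i u = u ≡ r ⊎ ∃ λ j → ∃ λ d → j < i × At cs j d × u ∈ inner d

  record ChainsInv (cs : List (Chain n m)) : Set where
    field
      shape       : ∀ {i c} → At cs i c → ChainShape c
      tgt-earlier : ∀ {i c} → At cs i c → RootOrEarlier cs i (tgt c)
      src-earlier : ∀ {i c} → At cs i c → RootOrEarlier cs i (src c)
      disjoint    : ∀ {i c j d u} → At cs i c → At cs j d → u ∈ inner c → u ∈ inner d → i ≡ j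
      src-sorted  : ∀ {i c j d} → At cs i c → At cs j d → i ≤ j → pos (src c) ≤ pos (src d)

  record Visited (vis : Fin n → Bool) (cs : List (Chain n m)) : Set where
    field
      visited⇒ : ∀ u → vis u ≡ true → RootOrInner cs u
      ⇒visited : ∀ u → RootOrInner cs u → vis u ≡ true
      closed   : ∀ u u′ → vis u ≡ true → u′ ≤T u → vis u′ ≡ true

  no-chains : ChainsInv []
  no-chains = record { shape = λ () ; tgt-earlier = λ () ; src-earlier = λ ()
                     ; disjoint = λ () ; src-sorted = λ () }

  Visited-cong : ∀ {vis vis′ cs} → (∀ u → vis u ≡ vis′ u) → Visited vis cs → Visited vis′ cs
  Visited-cong {vis} {vis′} same V = record
    { visited⇒ = λ u e → visited⇒ u (trans (same u) e)
    ; ⇒visited = λ u h → trans (sym (same u)) (⇒visited u h)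
    ; closed   = λ u u′ e u′≤u → trans (sym (same u′)) (closed u u′ (trans (same u) e) u′≤u) }
    where open Visited V

  snoc-RootOrInner : ∀ {cs c u} → RootOrInner cs u → RootOrEarlier (cs ++ c ∷ []) (length cs) u
  snoc-RootOrInner (inj₁ u≡r)             = inj₁ u≡r
  snoc-RootOrInner (inj₂ (j , d , at , u∈)) = inj₂ (j , d , At-< at , At-++ˡ at , u∈)

  snoc-RootOrEarlier : ∀ {cs c i u} → RootOrEarlier cs i u → RootOrEarlier (cs ++ c ∷ []) i u
  snoc-RootOrEarlier (inj₁ u≡r)                   = inj₁ u≡r
  snoc-RootOrEarlier (inj₂ (j , d , j<i , at , u∈)) = inj₂ (j , d , j<i , At-++ˡ at , u∈)

  snoc-InInner : ∀ {cs c u} → InInner cs u → InInner (cs ++ c ∷ []) u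
  snoc-InInner (j , d , at , u∈) = j , d , At-++ˡ at , u∈

  snoc-chains : ∀ {cs c} → ChainsInv cs → ChainShape c →
                RootOrInner cs (tgt c) → RootOrInner cs (src c) →
                (∀ u → u ∈ inner c → ¬ InInner cs u) →
                (∀ {i d} → At cs i d → pos (src d) ≤ pos (src c)) →
                ChainsInv (cs ++ c ∷ [])
  snoc-chains {cs} {c} I S tgt-old src-old fresh src-last = record
    { shape = shape′ ; tgt-earlier = tgt′ ; src-earlier = src′
    ; disjoint = disjoint′ ; src-sorted = sorted′ }
    where
    open ChainsInv I
    shape′ : ∀ {i c′} → At (cs ++ c ∷ []) i c′ → ChainShape c′
    shape′ at with At-snoc⁻ cs at
    ... | inj₁ at′           = shape at′
    ... | inj₂ (refl , refl) = S
    tgt′ : ∀ {i c′} → At (cs ++ c ∷ []) i c′ → RootOrEarlier (cs ++ c ∷ []) i (tgt c′)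
    tgt′ at with At-snoc⁻ cs at
    ... | inj₁ at′           = snoc-RootOrEarlier (tgt-earlier at′)
    ... | inj₂ (refl , refl) = snoc-RootOrInner tgt-old
    src′ : ∀ {i c′} → At (cs ++ c ∷ []) i c′ → RootOrEarlier (cs ++ c ∷ []) i (src c′)
    src′ at with At-snoc⁻ cs at
    ... | inj₁ at′           = snoc-RootOrEarlier (src-earlier at′)
    ... | inj₂ (refl , refl) = snoc-RootOrInner src-old
    disjoint′ : ∀ {i c₁ j c₂ u} → At (cs ++ c ∷ []) i c₁ → At (cs ++ c ∷ []) j c₂ →
                u ∈ inner c₁ → u ∈ inner c₂ → i ≡ j
    disjoint′ at₁ at₂ u∈₁ u∈₂ with At-snoc⁻ cs at₁ | At-snoc⁻ cs at₂
    ... | inj₁ at₁′           | inj₁ at₂′           = disjoint at₁′ at₂′ u∈₁ u∈₂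
    ... | inj₁ at₁′           | inj₂ (refl , refl) = ⊥-elim (fresh _ u∈₂ (_ , _ , at₁′ , u∈₁))
    ... | inj₂ (refl , refl) | inj₁ at₂′           = ⊥-elim (fresh _ u∈₁ (_ , _ , at₂′ , u∈₂))
    ... | inj₂ (refl , refl) | inj₂ (refl , refl) = refl
    sorted′ : ∀ {i c₁ j c₂} → At (cs ++ c ∷ []) i c₁ → At (cs ++ c ∷ []) j c₂ → i ≤ j →
              pos (src c₁) ≤ pos (src c₂)
    sorted′ at₁ at₂ i≤j with At-snoc⁻ cs at₁ | At-snoc⁻ cs at₂
    ... | inj₁ at₁′           | inj₁ at₂′           = src-sorted at₁′ at₂′ i≤j
    ... | inj₁ at₁′           | inj₂ (refl , refl) = src-last at₁′
    ... | inj₂ (refl , refl) | inj₁ at₂′           = ⊥-elim (<⇒≱ (At-< at₂′) i≤j)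
    ... | inj₂ (refl , refl) | inj₂ (refl , refl) = ≤-refl

  snoc-visited : ∀ {vis cs c} → Visited vis cs →
                 (∀ {u u′} → u ∈ inner c → u′ ≤T u → u′ ∈ inner c ⊎ vis u′ ≡ true) →
                 Visited (markAll (inner c) vis) (cs ++ c ∷ [])
  snoc-visited {vis} {cs} {c} V up-closed = record
    { visited⇒ = visited⇒′ ; ⇒visited = ⇒visited′ ; closed = closed′ }
    where
    open Visited V
    visited⇒′ : ∀ u → markAll (inner c) vis u ≡ true → RootOrInner (cs ++ c ∷ []) u
    visited⇒′ u e with markAll⁻ (inner c) vis u e
    ... | inj₁ u∈ = inj₂ (length cs , c , At-snoc cs c , u∈)
    ... | inj₂ vu with visited⇒ u vu
    ...   | inj₁ u≡r = inj₁ u≡r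
    ...   | inj₂ old = inj₂ (snoc-InInner old)
    ⇒visited′ : ∀ u → RootOrInner (cs ++ c ∷ []) u → markAll (inner c) vis u ≡ true
    ⇒visited′ u (inj₁ u≡r) = markAll-mono (inner c) vis u (⇒visited u (inj₁ u≡r))
    ⇒visited′ u (inj₂ (i , d , at , u∈)) with At-snoc⁻ cs at
    ... | inj₁ at′           = markAll-mono (inner c) vis u (⇒visited u (inj₂ (i , d , at′ , u∈)))
    ... | inj₂ (refl , refl) = markAll-∈ (inner c) vis u u∈
    closed′ : ∀ u u′ → markAll (inner c) vis u ≡ true → u′ ≤T u → markAll (inner c) vis u′ ≡ true
    closed′ u u′ e u′≤u with markAll⁻ (inner c) vis u e
    ... | inj₂ vu = markAll-mono (inner c) vis u′ (closed u u′ vu u′≤u)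
    ... | inj₁ u∈ with up-closed u∈ u′≤u
    ...   | inj₁ u′∈  = markAll-∈ (inner c) vis u′ u′∈
    ...   | inj₂ vu′ = markAll-mono (inner c) vis u′ vu′

  record Processed (K : ℕ) (vis : Fin n → Bool) (cs : List (Chain n m)) : Set where
    field
      chainsInv  : ChainsInv cs
      visited    : Visited vis cs
      src-before : ∀ {i c} → At cs i c → pos (src c) < K
      back-done  : ∀ {s e w} → pos s < K → Back s e w → vis w ≡ true

  record Processing (v : Fin n) (hs : List (Fin m)) (vis : Fin n → Bool) (cs : List (Chain n m)) : Set where
    field
      chainsInv : ChainsInv cs
      visited   : Visited vis cs
      src-upto  : ∀ {i c} → At cs i c → pos (src c) ≤ pos v
      back-done : ∀ {s e w} → pos s < pos v → Back s e w → vis w ≡ true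
      own-done  : ∀ {e w} → e ∈ hs → Back v e w → vis w ≡ true
      v-in      : RootOrInner cs v

  add-chain : ∀ {v hs vis cs e w l} → Processing v hs vis cs → Back v e w →
              vis (iter parent l w) ≡ true → (∀ t → t < l → vis (iter parent t w) ≡ false) →
              Processing v (e ∷ hs) (markAll (path w l) vis)
                         (cs ++ mkChain v e (path w l) (iter parent l w) ∷ [])
  add-chain {v} {hs} {vis} {cs} {e} {w} {l} P back@(_ , j , _) vis-end unvisited = record
    { chainsInv = snoc-chains chainsInv shape (visited⇒ _ vis-end) v-in fresh src-upto
    ; visited   = snoc-visited visited up-closed
    ; src-upto  = src-upto′
    ; back-done = λ lt b → markAll-mono (path w l) vis _ (back-done lt b)
    ; own-done  = own-done′
    ; v-in      = map₂ snoc-InInner v-in }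
    where
    open Processing P
    open Visited visited
    c : Chain n m
    c = mkChain v e (path w l) (iter parent l w)
    shape : ChainShape c
    shape = climbed-chain-shape (⇒visited r (inj₁ refl)) (⇒visited v v-in) back unvisited
    fresh : ∀ u → u ∈ path w l → ¬ InInner cs u
    fresh u u∈ old = climbed-unvisited unvisited u∈ (⇒visited u (inj₂ old))
    up-closed : ∀ {u u′} → u ∈ path w l → u′ ≤T u → u′ ∈ path w l ⊎ vis u′ ≡ true
    up-closed u∈ u′≤u = map₂ (closed _ _ vis-end) (ancestor-of-path w l u∈ u′≤u)
    src-upto′ : ∀ {i c′} → At (cs ++ c ∷ []) i c′ → pos (src c′) ≤ pos v
    src-upto′ at with At-snoc⁻ cs at
    ... | inj₁ at′           = src-upto at′
    ... | inj₂ (refl , refl) = ≤-refl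
    own-done′ : ∀ {e′ w′} → e′ ∈ e ∷ hs → Back v e′ w′ → markAll (path w l) vis w′ ≡ true
    own-done′ (here refl) (_ , j′ , _) =
      subst (λ z → markAll (path w l) vis z ≡ true) (joins-unique j j′) (markAll-start w l vis vis-end)
    own-done′ (there e′∈) b = markAll-mono (path w l) vis _ (own-done e′∈ b)

  edge-step : ∀ {v hs vis cs e} → Processing v hs vis cs → e ∈ backOrder D v →
              Processing v (e ∷ hs) (proj₁ (processEdge v (vis , cs) e)) (proj₂ (processEdge v (vis , cs) e))
  edge-step {v} {hs} {vis} {cs} {e} P e∈ with Equivalence.to (backSpec D v e) e∈
  ... | nt , w , j , v<w = handled
    where
    w′ : Fin n
    w′ = otherEnd e v
    w′≡w : w′ ≡ w
    w′≡w = otherEnd-joins j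
    back : Back v e w′
    back = nt , subst (Joins G e v) (sym w′≡w) j , subst (v <T_) (sym w′≡w) v<w
    -- the root is visited, so fuel n suffices for the climb
    reaches-visited : ∃ λ k → k ≤ n × vis (iter parent k w′) ≡ true
    reaches-visited = pos w′ , <⇒≤ (FP.toℕ<n (index w′)) ,
      trans (cong vis (reach-root (pos w′) w′ ≤-refl))
            (Visited.⇒visited (Processing.visited P) r (inj₁ refl))
    handled : Processing v (e ∷ hs) (proj₁ (processEdge v (vis , cs) e)) (proj₂ (processEdge v (vis , cs) e))
    handled with climb n vis w′ | climb-spec n vis w′ reaches-visited
    ... | is , x | l , refl , refl , vis-end , unvisited = add-chain P back vis-end unvisited

  Before : ℕ → State → Set
  Before zero    s = s ≡ ((λ _ → false) , [])
  Before (suc k) s = Processed (suc k) (proj₁ s) (proj₂ s)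

  start-root : ∀ {x} → toℕ x ≡ 0 → Processing (ord D x) [] (mark (ord D x) (λ _ → false)) []
  start-root {x} x≡0 = record
    { chainsInv = no-chains
    ; visited   = record { visited⇒ = visited⇒ ; ⇒visited = ⇒visited ; closed = closed }
    ; src-upto  = λ ()
    ; back-done = λ {s} lt _ → ⊥-elim (n≮0 (subst (pos s <_) (trans (cong pos v≡r) pos-root) lt))
    ; own-done  = λ ()
    ; v-in      = inj₁ v≡r }
    where
    v : Fin n
    v = ord D x
    v≡r : v ≡ r
    v≡r = ordZero D x x≡0
    vis : Fin n → Bool
    vis = mark v (λ _ → false)
    ⇒visited : ∀ u → RootOrInner [] u → vis u ≡ true
    ⇒visited u (inj₁ refl) = subst (λ z → vis z ≡ true) v≡r (mark-self v _)
    visited⇒ : ∀ u → vis u ≡ true → RootOrInner [] u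
    visited⇒ u e with mark⁻ v _ u e
    ... | inj₁ u≡v = inj₁ (trans u≡v v≡r)
    closed : ∀ u u′ → vis u ≡ true → u′ ≤T u → vis u′ ≡ true
    closed u u′ e u′≤u with visited⇒ u e
    ... | inj₁ refl = ⇒visited u′ (inj₁ (≤T-root u′≤u))

  -- Starting a later vertex v: v is already visited, because a back-edge
  -- from an earlier vertex jumps over the tree edge {v, p(v)}.
  start-later : TwoEdgeConnected G → ∀ {vis cs v} → v ≢ r → Processed (pos v) vis cs →
                Processing v [] (mark v vis) cs
  start-later tec {vis} {cs} {v} v≢r P = record
    { chainsInv = chainsInv
    ; visited   = Visited-cong (λ u → sym (unchanged u)) visited
    ; src-upto  = λ at → <⇒≤ (src-before at)
    ; back-done = λ lt b → trans (unchanged _) (back-done lt b)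
    ; own-done  = λ ()
    ; v-in      = Visited.visited⇒ visited v vis-v }
    where
    open Processed P
    vis-v : vis v ≡ true
    vis-v with covering-back-edge tec v v≢r
    ... | s , e , u , s<v , v≤u , b =
      Visited.closed visited u v (back-done (<T⇒pos< s<v) b) v≤u
    unchanged : ∀ u → mark v vis u ≡ vis u
    unchanged = mark-visited v vis vis-v

  finish-vertex : ∀ {v hs vis cs} → Processing v hs vis cs →
                  (∀ e → e ∈ backOrder D v → e ∈ hs) → Processed (suc (pos v)) vis cs
  finish-vertex {v} {hs} {vis} {cs} P all-handled = record
    { chainsInv  = chainsInv
    ; visited    = visited
    ; src-before = λ at → s≤s (src-upto at)
    ; back-done  = back-done′ }
    where
    open Processing P
    back-done′ : ∀ {s e w} → pos s < suc (pos v) → Back s e w → vis w ≡ true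
    back-done′ {s} {e} {w} lt b@(nt , j , s<w) with m≤n⇒m<n∨m≡n (≤-pred lt)
    ... | inj₁ lt′ = back-done lt′ b
    ... | inj₂ eq with pos-injective {s} {v} eq
    ...   | refl = own-done (all-handled e (Equivalence.from (backSpec D v e) (nt , w , j , s<w))) b

  vertex-step : TwoEdgeConnected G → ∀ x s → Before (toℕ x) s →
                Before (suc (toℕ x)) (processVertex s (ord D x))
  vertex-step tec x (vis , cs) before =
    let hs , all-handled , P = foldl-invariant (processEdge v) Inv (backOrder D v)
                                 (λ e hs st e∈ P → edge-step P e∈) (mark v vis , cs) (start x before)
    in subst (λ k → Processed (suc k) (proj₁ final) (proj₂ final)) (pos-ord x) (finish-vertex P all-handled)
    where
    v : Fin n
    v = ord D x
    Inv : List (Fin m) → State → Set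
    Inv hs st = Processing v hs (proj₁ st) (proj₂ st)
    final : State
    final = foldl (processEdge v) (mark v vis , cs) (backOrder D v)
    start : ∀ x → Before (toℕ x) (vis , cs) → Processing (ord D x) [] (mark (ord D x) vis) cs
    start F.zero    refl = start-root {F.zero} refl
    start (F.suc y) P    =
      start-later tec v≢r (subst (λ k → Processed k vis cs) (sym (pos-ord (F.suc y))) P)
      where
      v≢r : ord D (F.suc y) ≢ r
      v≢r eq with () ← trans (sym (pos-ord (F.suc y))) (trans (cong pos eq) pos-root)

  chains-inv : TwoEdgeConnected G → ChainsInv chains
  chains-inv tec = final n _ (foldl-allFin (λ st k → processVertex st (ord D k)) Before
                                           (vertex-step tec) ((λ _ → false) , []) refl)
    where
    final : ∀ k s → Before k s → ChainsInv (proj₂ s)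
    final zero    s refl = no-chains
    final (suc k) s P    = Processed.chainsInv P

module Properties {n m} (G : Graph n m) (D : DFS G) (tec : TwoEdgeConnected G) where
  open ChainDecomposition G D
  open TreeOrder G D
  open Steps G D
  open Invariant G D
  open ChainsInv (chains-inv tec)

  at : ∀ i → At chains (toℕ i) (C i)
  at i = At-lookup chains i

  shape-of : ∀ i → ChainShape (C i)
  shape-of i = shape (at i)

  -- A vertex v ≠ r s-belongs to C i exactly when it is an inner vertex of
  -- C i: the back-edge of a chain is not a tree edge.
  sbelongs⇒inner : ∀ {u i} → u ≢ r → te D u ∈ edges (C i) → u ∈ inner (C i)
  sbelongs⇒inner {u} {i} u≢r (here te≡back) = ⊥-elim (ChainShape.back-nontree (shape-of i) u u≢r te≡back)
  sbelongs⇒inner {u} {i} u≢r (there te∈) with ∈-map⁻ (te D) te∈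
  ... | y , y∈ , te≡ =
    subst (_∈ inner (C i)) (sym (te-injective u≢r (ChainShape.inner-nonroot (shape-of i) y y∈) te≡)) y∈

  inner⇒sbelongs : ∀ {u i} → u ∈ inner (C i) → SBelongs u i
  inner⇒sbelongs {u} {i} u∈ =
    inj₂ (ChainShape.inner-nonroot (shape-of i) u u∈ , there (∈-map⁺ (te D) u∈))

  sbelongs-unique : ∀ {u i j} → SBelongs u i → SBelongs u j → i ≡ j
  sbelongs-unique (inj₁ (_ , i≡0)) (inj₁ (_ , j≡0)) = FP.toℕ-injective (trans i≡0 (sym j≡0))
  sbelongs-unique (inj₁ (refl , _)) (inj₂ (r≢r , _)) = ⊥-elim (r≢r refl)
  sbelongs-unique (inj₂ (r≢r , _)) (inj₁ (refl , _)) = ⊥-elim (r≢r refl)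
  sbelongs-unique {i = i} {j} (inj₂ (u≢r , te∈i)) (inj₂ (u≢r′ , te∈j)) =
    FP.toℕ-injective (disjoint (at i) (at j) (sbelongs⇒inner u≢r te∈i) (sbelongs⇒inner u≢r′ te∈j))

  sbelongs-root : ∀ {i} → SBelongs r i → toℕ i ≡ 0
  sbelongs-root (inj₁ (_ , i≡0))  = i≡0
  sbelongs-root (inj₂ (r≢r , _)) = ⊥-elim (r≢r refl)

  earlier-chain : ∀ (i : Idx) {u} → RootOrEarlier chains (toℕ i) u →
                  u ≡ r ⊎ Σ Idx λ j → toℕ j < toℕ i × u ∈ inner (C j)
  earlier-chain i (inj₁ u≡r) = inj₁ u≡r
  earlier-chain i (inj₂ (_ , _ , lt , at′ , u∈)) with At⇒lookup at′
  ... | j , refl , refl = inj₂ (j , lt , u∈)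

  earlier-than-first : ∀ (i : Idx) {u} → toℕ i ≡ 0 → RootOrEarlier chains (toℕ i) u → u ≡ r
  earlier-than-first i i≡0 h with earlier-chain i h
  ... | inj₁ u≡r          = u≡r
  ... | inj₂ (_ , lt , _) = ⊥-elim (n≮0 (subst (_ <_) i≡0 lt))

  root-or-earlier-sbelongs : ∀ (i : Idx) {u} → toℕ i ≢ 0 → RootOrEarlier chains (toℕ i) u →
                             Σ Idx λ j → toℕ j < toℕ i × SBelongs u j
  root-or-earlier-sbelongs i i≢0 h with earlier-chain i h
  ... | inj₁ u≡r = let j , j≡0 = fin-zero i in
    j , subst (_< toℕ i) (sym j≡0) (n≢0⇒n>0 i≢0) , inj₁ (u≡r , j≡0)
  ... | inj₂ (j , lt , u∈) = j , lt , inner⇒sbelongs u∈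

  src≤tgt : ∀ i → src (C i) ≤T tgt (C i)
  src≤tgt i = ChainShape.src≤tgt (shape-of i)

  parent-exists : ∀ i → toℕ i ≢ 0 → ∃[ j ] IsParent i j
  parent-exists i i≢0 = let j , _ , sb = root-or-earlier-sbelongs i i≢0 (tgt-earlier (at i)) in j , i≢0 , sb

  -- (2), the parent has a smaller index: t(C_i) s-belongs to an earlier chain.
  parent-index< : ∀ i j → IsParent i j → toℕ j < toℕ i
  parent-index< i j (i≢0 , sb) =
    let k , k<i , sb′ = root-or-earlier-sbelongs i i≢0 (tgt-earlier (at i))
    in subst (λ j′ → toℕ j′ < toℕ i) (sbelongs-unique sb′ sb) k<i

  -- (2), the sources: s(p(C_i)) ≤ t(C_i) and s(C_i) ≤ t(C_i) are comparable,
  -- and s(C_i) < s(p(C_i)) is excluded since sources appear in discovery order.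
  parent-src : ∀ i j → IsParent i j → src (C j) ≤T src (C i)
  parent-src i j (_ , inj₁ (_ , j≡0)) =
    subst (_≤T src (C i)) (sym (earlier-than-first j j≡0 (src-earlier (at j)))) (r≤T _)
  parent-src i j isp@(_ , inj₂ (tgt≢r , te∈)) with src (C j) ≤T? src (C i)
  ... | yes sj≤si = sj≤si
  ... | no sj≰si  = ⊥-elim (<⇒≱ (<T⇒pos< (≰⇒<T sj≤ti (src≤tgt i) sj≰si))
                                (src-sorted (at j) (at i) (<⇒≤ (parent-index< i j isp))))
    where
    sj≤ti : src (C j) ≤T tgt (C i)
    sj≤ti = ≤T-trans (src≤tgt j) (proj₁ (inner-below (shape-of j) (sbelongs⇒inner tgt≢r te∈)))

  parent-tgt : ∀ i j → IsParent i j →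
               (tgt (C i) ≢ r → tgt (C j) <T tgt (C i)) × (tgt (C i) ≡ r → tgt (C j) ≡ tgt (C i))
  parent-tgt i j (_ , inj₁ (tgt≡r , j≡0)) =
    (λ tgt≢r → ⊥-elim (tgt≢r tgt≡r)) ,
    (λ _ → trans (earlier-than-first j j≡0 (tgt-earlier (at j))) (sym tgt≡r))
  parent-tgt i j (_ , inj₂ (tgt≢r , te∈)) =
    (λ _ → inner-below (shape-of j) (sbelongs⇒inner tgt≢r te∈)) , (λ tgt≡r → ⊥-elim (tgt≢r tgt≡r))

  below-inner : ∀ {u y} k → y ∈ inner (C k) → u ≤T y → u ≤T tgt (C k) ⊎ SBelongs u k
  below-inner {u} k y∈ u≤y with u ≤T? tgt (C k)
  ... | yes u≤t = inj₁ u≤t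
  ... | no u≰t  = inj₂ (inner⇒sbelongs (inner-between (shape-of k) y∈ t<u u≤y))
    where
    t<u : tgt (C k) <T u
    t<u = ≰⇒<T u≤y (proj₁ (inner-below (shape-of k) y∈)) u≰t

  root-chain : ∀ {i j} → SBelongs r i → toℕ j ≡ 0 → i ≡ j
  root-chain sb j≡0 = FP.toℕ-injective (trans (sbelongs-root sb) (sym j≡0))

  order-at-root : ∀ {u i} j → tgt (C j) ≡ r → u ≤T tgt (C j) → SBelongs u i → i ≤C j
  order-at-root {u} {i} j tj≡r u≤tj sb with ≤T-root (subst (u ≤T_) tj≡r u≤tj)
  ... | refl with toℕ {length chains} j Data.Nat.≟ 0
  ...   | yes j≡0 = subst (_≤C j) (sym (root-chain sb j≡0)) ≤C-refl
  ...   | no j≢0  = ≤C-step ≤C-refl (j≢0 , subst (λ z → SBelongs z i) (sym tj≡r) sb)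

  parent-via-inner : ∀ {j k} → toℕ k < toℕ j → tgt (C j) ∈ inner (C k) → IsParent j k
  parent-via-inner k<j tj∈k = (λ j≡0 → n≮0 (subst (_ <_) j≡0 k<j)) , inner⇒sbelongs tj∈k

  -- Either t(C_j) = r, so u = r, or
  -- t(C_j) is an inner vertex of the parent C_k; then u ≤ t(C_k) and the claim
  -- holds for C_k, or u s-belongs to C_k itself.
  chain-order-tgt : ∀ u i j → u ≤T tgt (C j) → SBelongs u i → i ≤C j
  chain-order-tgt u i j = go (suc (toℕ j)) j ≤-refl
    where
    go : ∀ b (j : Idx) → toℕ j < b → u ≤T tgt (C j) → SBelongs u i → i ≤C j
    go (suc b) j j<b u≤tj sb with earlier-chain j (tgt-earlier (at j))
    ... | inj₁ tj≡r = order-at-root j tj≡r u≤tj sb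
    ... | inj₂ (k , k<j , tj∈k) with below-inner k tj∈k u≤tj
    ... | inj₁ u≤tk = ≤C-step (go b k (≤-trans k<j (≤-pred j<b)) u≤tk sb) (parent-via-inner k<j tj∈k)
    ... | inj₂ sbk  = subst (_≤C j) (sbelongs-unique sbk sb) (≤C-step ≤C-refl (parent-via-inner k<j tj∈k))

  -- (4): if v s-belongs to C_j then v = r, or v is inner in C_j, and then
  -- u ≤ v lies below t(C_j) (use (5)) or s-belongs to C_j.
  chain-order : ∀ u v i j → u ≤T v → SBelongs u i → SBelongs v j → i ≤C j
  chain-order u v i j u≤v sbu (inj₁ (refl , j≡0)) =
    subst (_≤C j) (sym (root-chain (subst (λ z → SBelongs z i) (≤T-root u≤v) sbu) j≡0)) ≤C-refl
  chain-order u v i j u≤v sbu (inj₂ (v≢r , te∈)) with below-inner j (sbelongs⇒inner v≢r te∈) u≤v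
  ... | inj₁ u≤tj = chain-order-tgt u i j u≤tj sbu
  ... | inj₂ sbj  = subst (_≤C j) (sbelongs-unique sbj sbu) ≤C-refl

  src-sbelongs-earlier : ∀ i → toℕ i ≢ 0 → ∃[ j ] (toℕ j < toℕ i × SBelongs (src (C i)) j)
  src-sbelongs-earlier i i≢0 = root-or-earlier-sbelongs i i≢0 (src-earlier (at i))

lemma2 : ∀ {n m} (G : Graph n m) → MinDegree≥3 G → TwoEdgeConnected G →
         (D : DFS G) →
         let open ChainDecomposition G D in
         -- (1)
         (∀ i → src (C i) ≤T tgt (C i))
         -- (2)
         × (∀ i → toℕ i ≢ 0 →
              (∃[ j ] IsParent i j)
              × (∀ j → IsParent i j → src (C j) ≤T src (C i) × toℕ j < toℕ i))
         -- (3)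
         × (∀ i j → IsParent i j →
              (tgt (C i) ≢ r → tgt (C j) <T tgt (C i))
              × (tgt (C i) ≡ r → tgt (C j) ≡ tgt (C i)))
         -- (4)
         × (∀ u v i j → u ≤T v → SBelongs u i → SBelongs v j → i ≤C j)
         -- (5)
         × (∀ u i j → u ≤T tgt (C j) → SBelongs u i → i ≤C j)
         -- (6)
         × (∀ i → toℕ i ≢ 0 → ∃[ j ] (toℕ j < toℕ i × SBelongs (src (C i)) j))
lemma2 G _ tec D =
  src≤tgt ,
  (λ i i≢0 → parent-exists i i≢0 , λ j isp → parent-src i j isp , parent-index< i j isp) ,
  parent-tgt ,
  chain-order ,
  chain-order-tgt ,
  src-sbelongs-earlier
  where open Properties G D tec
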